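{- If $G$ is a bipartite graph and $G\in\mathfrak{N}$, then $S(G)\in\mathfrak{N}$.
   Context: All graphs are finite, without loops or multiple edges. An interval $t$-coloring of a graph $G$ is a proper edge-coloring of $G$ with colors $1,\ldots,t$ such that every color is used and for every vertex $v$ the set of colors of edges incident to $v$ is an interval of integers. $\mathfrak{N}$ denotes the set of graphs having an interval $t$-coloring for some positive integer $t$. $S(G)$ denotes the graph obtained from $G$ by subdividing every edge once: for each edge $v_iv_j$ of $G$ a new vertex $w_{ij}$ is added and the edge $v_iv_j$ is replaced by the edges $v_iw_{ij}$ and $v_jw_{ij}$. -}

module Defs where

open import Data.Nat using (ℕ; _≤_; _+_)
open import Data.Fin using (Fin; splitAt; _↑ˡ_; _↑ʳ_)
open import Data.Product using (_×_; _,_; proj₁; proj₂; ∃)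
open import Data.Sum using (_⊎_; inj₁; inj₂)
open import Data.Bool using (Bool)
open import Relation.Binary.PropositionalEquality using (_≡_; _≢_)

record EdgeStructure : Set where
  field
    n    : ℕ
    m    : ℕ
    ends : Fin m → Fin n × Fin n
open EdgeStructure public

SameEnds : {n : ℕ} → Fin n × Fin n → Fin n × Fin n → Set
SameEnds (a , b) (c , d) = (a ≡ c × b ≡ d) ⊎ (a ≡ d × b ≡ c)

record Graph : Set where
  field
    struct  : EdgeStructure
    noLoop  : ∀ e → proj₁ (ends struct e) ≢ proj₂ (ends struct e)
    noMulti : ∀ e e' → SameEnds (ends struct e) (ends struct e') → e ≡ e'
open Graph public

Incident : (G : EdgeStructure) → Fin (n G) → Fin (m G) → Set
Incident G v e = proj₁ (ends G e) ≡ v ⊎ proj₂ (ends G e) ≡ v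

record IntervalColoring (G : EdgeStructure) (t : ℕ) : Set where
  field
    col      : Fin (m G) → ℕ
    range    : ∀ e → 1 ≤ col e × col e ≤ t
    proper   : ∀ v e e' → Incident G v e → Incident G v e' → col e ≡ col e' → e ≡ e'
    surj     : ∀ k → 1 ≤ k → k ≤ t → ∃ λ e → col e ≡ k
    interval : ∀ v e e' k → Incident G v e → Incident G v e' →
               col e ≤ k → k ≤ col e' → ∃ λ e'' → Incident G v e'' × col e'' ≡ k

InN : EdgeStructure → Set
InN G = ∃ λ t → 1 ≤ t × IntervalColoring G t

Bipartite : Graph → Set
Bipartite G = ∃ λ (f : Fin (n (struct G)) → Bool) →
  ∀ e → f (proj₁ (ends (struct G) e)) ≢ f (proj₂ (ends (struct G) e))

-- Subdivision S(G): vertices are the old vertices (Fin n, via ↑ˡ) followed by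
-- one new vertex w_k per edge k (via ↑ʳ).  Edge k gives edges v_i w_k (first
-- copy, index k ↑ˡ m) and v_j w_k (second copy, index m ↑ʳ k).
S : EdgeStructure → EdgeStructure
S G = record { n = n G + m G ; m = m G + m G ; ends = es }
  where
  es : Fin (m G + m G) → Fin (n G + m G) × Fin (n G + m G)
  es x with splitAt (m G) x
  ... | inj₁ k = (proj₁ (ends G k) ↑ˡ m G) , (n G ↑ʳ k)
  ... | inj₂ k = (proj₂ (ends G k) ↑ˡ m G) , (n G ↑ʳ k)

module Submission where

-- Let side : V → Bool be a bipartition of G and α an interval
-- t-colouring of G.  In S(G) every edge e = v₁v₂ of G becomes two "half-edges"
-- vᵢ w_e; colour the half-edge at vᵢ with  α(e) + [side vᵢ]  where [true] = 1
-- and [false] = 0.  At an old vertex v all incident half-edges are shifted by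
-- the same amount [side v], so properness and the interval property are
-- inherited from α.  At a new vertex w_e the two endpoints of e lie on
-- different sides, so the two half-edges get the colours α(e) and α(e) + 1:
-- distinct and consecutive.  The colours used are exactly 1, …, t + 1.

open import Defs
open import Data.Nat using (ℕ; _+_; _∸_; _≤_; _≤?_; s≤s; z≤n)
open import Data.Nat.Properties
open import Data.Fin using (Fin; splitAt; _↑ˡ_; _↑ʳ_)
open import Data.Fin.Properties
  using (splitAt-↑ˡ; splitAt-↑ʳ; splitAt⁻¹-↑ˡ; splitAt⁻¹-↑ʳ; ↑ˡ-injective; ↑ʳ-injective)
open import Data.Product using (_×_; _,_; proj₁; proj₂; ∃)
open import Data.Sum using (_⊎_; inj₁; inj₂; [_,_]′)
open import Data.Bool using (Bool; true; false)
open import Data.Empty using (⊥-elim)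
open import Relation.Nullary using (yes; no)
open import Relation.Binary.PropositionalEquality

bit : Bool → ℕ
bit true  = 1
bit false = 0

bit≤1 : ∀ b → bit b ≤ 1
bit≤1 true  = s≤s z≤n
bit≤1 false = z≤n

bit-injective : ∀ {b c} → bit b ≡ bit c → b ≡ c
bit-injective {true}  {true}  _ = refl
bit-injective {false} {false} _ = refl

between-shift : ∀ {a K} → a ≤ K → K ≤ a + 1 → ∃ λ b → a + bit b ≡ K
between-shift {a} {K} a≤K K≤a+1 with K ≤? a
... | yes K≤a = false , trans (+-identityʳ a) (≤-antisym a≤K K≤a)
... | no  K≰a = true , ≤-antisym (subst (_≤ K) (+-comm 1 a) (≰⇒> K≰a)) K≤a+1

unshift : ∀ {a b K} c → a + c ≤ K → K ≤ b + c →
          ∃ λ L → a ≤ L × L ≤ b × L + c ≡ K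
unshift {a} {b} {K} c a+c≤K K≤b+c =
    K ∸ c
  , subst (_≤ K ∸ c) (m+n∸n≡m a c) (∸-monoˡ-≤ c a+c≤K)
  , subst (K ∸ c ≤_) (m+n∸n≡m b c) (∸-monoˡ-≤ c K≤b+c)
  , m∸n+n≡m (≤-trans (m≤n+m c a) a+c≤K)

both-differ : ∀ {a b c : Bool} → a ≢ c → b ≢ c → a ≡ b
both-differ {false} {false} _ _ = refl
both-differ {true}  {true}  _ _ = refl
both-differ {false} {true}  {false} a≢c _ = ⊥-elim (a≢c refl)
both-differ {false} {true}  {true}  _ b≢c = ⊥-elim (b≢c refl)
both-differ {true}  {false} {false} _ b≢c = ⊥-elim (b≢c refl)
both-differ {true}  {false} {true}  a≢c _ = ⊥-elim (a≢c refl)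

module Subdivision (E : EdgeStructure) where

  private
    N = n E
    M = m E

  endpoint : Fin M → Bool → Fin N
  endpoint k true  = proj₁ (ends E k)
  endpoint k false = proj₂ (ends E k)

  half : Fin M → Bool → Fin (M + M)
  half k true  = k ↑ˡ M
  half k false = M ↑ʳ k

  ends-half : ∀ k s → ends (S E) (half k s) ≡ (endpoint k s ↑ˡ M , N ↑ʳ k)
  ends-half k true  rewrite splitAt-↑ˡ M k M = refl
  ends-half k false rewrite splitAt-↑ʳ M M k = refl

  data HalfView : Fin (M + M) → Set where
    half-of : ∀ k s → HalfView (half k s)

  halfView : ∀ x → HalfView x
  halfView x with splitAt M x in eq
  ... | inj₁ k = subst HalfView (splitAt⁻¹-↑ˡ eq) (half-of k true)
  ... | inj₂ k = subst HalfView (splitAt⁻¹-↑ʳ eq) (half-of k false)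

  data VertexView : Fin (N + M) → Set where
    old : ∀ u → VertexView (u ↑ˡ M)
    new : ∀ j → VertexView (N ↑ʳ j)

  vertexView : ∀ v → VertexView v
  vertexView v with splitAt N v in eq
  ... | inj₁ u = subst VertexView (splitAt⁻¹-↑ˡ eq) (old u)
  ... | inj₂ j = subst VertexView (splitAt⁻¹-↑ʳ eq) (new j)

  old≢new : ∀ u j → u ↑ˡ M ≢ N ↑ʳ j
  old≢new u j eq with trans (sym (splitAt-↑ˡ N u M)) (trans (cong (splitAt N) eq) (splitAt-↑ʳ N M j))
  ... | ()

  private
    incident-half : ∀ v k s → Incident (S E) v (half k s) →
                    endpoint k s ↑ˡ M ≡ v ⊎ N ↑ʳ k ≡ v
    incident-half v k s = subst (λ p → proj₁ p ≡ v ⊎ proj₂ p ≡ v) (ends-half k s)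

  incident-old : ∀ {u} k s → Incident (S E) (u ↑ˡ M) (half k s) → endpoint k s ≡ u
  incident-old {u} k s i with incident-half _ k s i
  ... | inj₁ eq = ↑ˡ-injective M _ _ eq
  ... | inj₂ eq = ⊥-elim (old≢new u k (sym eq))

  half-incident-old : ∀ k s → Incident (S E) (endpoint k s ↑ˡ M) (half k s)
  half-incident-old k s = subst (λ p → proj₁ p ≡ endpoint k s ↑ˡ M ⊎ proj₂ p ≡ endpoint k s ↑ˡ M)
                                (sym (ends-half k s)) (inj₁ refl)

  incident-new : ∀ {j} k s → Incident (S E) (N ↑ʳ j) (half k s) → k ≡ j
  incident-new {j} k s i with incident-half _ k s i
  ... | inj₁ eq = ⊥-elim (old≢new (endpoint k s) j eq)
  ... | inj₂ eq = ↑ʳ-injective N k j eq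

  half-incident-new : ∀ k s → Incident (S E) (N ↑ʳ k) (half k s)
  half-incident-new k s = subst (λ p → proj₁ p ≡ N ↑ʳ k ⊎ proj₂ p ≡ N ↑ʳ k)
                                (sym (ends-half k s)) (inj₂ refl)

  endpoint-incident : ∀ k s → Incident E (endpoint k s) k
  endpoint-incident k true  = inj₁ refl
  endpoint-incident k false = inj₂ refl

  incident-endpoint : ∀ {u k} → Incident E u k → ∃ λ s → endpoint k s ≡ u
  incident-endpoint (inj₁ eq) = true  , eq
  incident-endpoint (inj₂ eq) = false , eq

module SubdivisionColouring
  (E : EdgeStructure)
  (side : Fin (n E) → Bool)
  (bipartite : ∀ e → side (proj₁ (ends E e)) ≢ side (proj₂ (ends E e)))
  {t : ℕ} (α : IntervalColoring E t)
  where

  open Subdivision E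
  open IntervalColoring α

  private
    M = m E

  ends-separated : ∀ k s s' → side (endpoint k s) ≡ side (endpoint k s') → s ≡ s'
  ends-separated k true  true  _  = refl
  ends-separated k false false _  = refl
  ends-separated k true  false eq = ⊥-elim (bipartite k eq)
  ends-separated k false true  eq = ⊥-elim (bipartite k (sym eq))

  end-on-side : ∀ k c → ∃ λ s → side (endpoint k s) ≡ c
  end-on-side k c with side (endpoint k true) Data.Bool.≟ c
  ... | yes eq  = true , eq
  ... | no  neq = false , both-differ (λ eq → bipartite k (sym eq)) (λ eq → neq (sym eq))

  halfColour : Fin M → Bool → ℕ
  halfColour k s = col k + bit (side (endpoint k s))

  colour : Fin (M + M) → ℕ
  colour x = [ (λ k → halfColour k true) , (λ k → halfColour k false) ]′ (splitAt M x)

  colour-half : ∀ k s → colour (half k s) ≡ halfColour k s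
  colour-half k true  rewrite splitAt-↑ˡ M k M = refl
  colour-half k false rewrite splitAt-↑ʳ M M k = refl

  colour-at-old : ∀ {u} k s → Incident (S E) (u ↑ˡ M) (half k s) →
                  colour (half k s) ≡ col k + bit (side u)
  colour-at-old k s i =
    trans (colour-half k s) (cong (λ v → col k + bit (side v)) (incident-old k s i))

  incident-old-edge : ∀ {u} k s → Incident (S E) (u ↑ˡ M) (half k s) → Incident E u k
  incident-old-edge k s i = subst (λ v → Incident E v k) (incident-old k s i) (endpoint-incident k s)

  proper-at-old : ∀ u k s k' s' →
                  Incident (S E) (u ↑ˡ M) (half k s) → Incident (S E) (u ↑ˡ M) (half k' s') →
                  colour (half k s) ≡ colour (half k' s') → half k s ≡ half k' s'
  proper-at-old u k s k' s' i i' eq = same-half k≡k' (trans (incident-old k s i) (sym (incident-old k' s' i')))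
    where
    k≡k' : k ≡ k'
    k≡k' = proper u k k' (incident-old-edge k s i) (incident-old-edge k' s' i')
             (+-cancelʳ-≡ (bit (side u)) _ _
               (trans (sym (colour-at-old k s i)) (trans eq (colour-at-old k' s' i'))))
    same-half : k ≡ k' → endpoint k s ≡ endpoint k' s' → half k s ≡ half k' s'
    same-half refl eq' = cong (half k) (ends-separated k s s' (cong side eq'))

  -- The two half-edges of an edge k get different colours, as their ends
  -- lie on different sides.
  proper-at-new : ∀ k s s' → colour (half k s) ≡ colour (half k s') → s ≡ s'
  proper-at-new k s s' eq =
    ends-separated k s s' (bit-injective (+-cancelˡ-≡ (col k) _ _
      (trans (sym (colour-half k s)) (trans eq (colour-half k s')))))

  colour-proper : ∀ v x x' → Incident (S E) v x → Incident (S E) v x' →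
                  colour x ≡ colour x' → x ≡ x'
  colour-proper v x x' with vertexView v | halfView x | halfView x'
  ... | old u | half-of k s | half-of k' s' = proper-at-old u k s k' s'
  ... | new j | half-of k s | half-of k' s' = λ i i' →
    same-edge (incident-new k s i) (incident-new k' s' i')
    where
    same-edge : k ≡ j → k' ≡ j → colour (half k s) ≡ colour (half k' s') → half k s ≡ half k' s'
    same-edge refl refl eq = cong (half k) (proper-at-new k s s' eq)

  shifted-half : ∀ k b → ∃ λ s → colour (half k s) ≡ col k + bit b
  shifted-half k b with end-on-side k b
  ... | s , eq = s , trans (colour-half k s) (cong (λ c → col k + bit c) eq)

  -- Colours at an old vertex u are those of α at u, shifted by [side u].
  interval-at-old : ∀ u k s k' s' K →
                    Incident (S E) (u ↑ˡ M) (half k s) → Incident (S E) (u ↑ˡ M) (half k' s') →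
                    colour (half k s) ≤ K → K ≤ colour (half k' s') →
                    ∃ λ x → Incident (S E) (u ↑ˡ M) x × colour x ≡ K
  interval-at-old u k s k' s' K i i' lo hi
    with unshift (bit (side u)) (subst (_≤ K) (colour-at-old k s i) lo)
                                (subst (K ≤_) (colour-at-old k' s' i') hi)
  ... | L , k≤L , L≤k' , L+c≡K
    with interval u k k' L (incident-old-edge k s i) (incident-old-edge k' s' i') k≤L L≤k'
  ... | e , u∈e , e≡L with incident-endpoint u∈e
  ... | s'' , refl = half e s'' , half-incident-old e s'' , colour≡K
    where
    colour≡K : colour (half e s'') ≡ K
    colour≡K = begin
      colour (half e s'')                    ≡⟨ colour-half e s'' ⟩
      col e + bit (side (endpoint e s''))    ≡⟨ cong (_+ bit (side (endpoint e s''))) e≡L ⟩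
      L + bit (side (endpoint e s''))        ≡⟨ L+c≡K ⟩
      K                                      ∎
      where open ≡-Reasoning

  -- Colours at a new vertex w_k are α(k) and α(k) + 1.
  interval-at-new : ∀ k s s' K → colour (half k s) ≤ K → K ≤ colour (half k s') →
                    ∃ λ x → Incident (S E) (n E ↑ʳ k) x × colour x ≡ K
  interval-at-new k s s' K lo hi with between-shift k≤K K≤k+1
    where
    k≤K : col k ≤ K
    k≤K = ≤-trans (m≤m+n (col k) _) (subst (_≤ K) (colour-half k s) lo)
    K≤k+1 : K ≤ col k + 1
    K≤k+1 = ≤-trans (subst (K ≤_) (colour-half k s') hi) (+-monoʳ-≤ (col k) (bit≤1 _))
  ... | b , k+b≡K with shifted-half k b
  ... | s'' , eq = half k s'' , half-incident-new k s'' , trans eq k+b≡K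

  colour-interval : ∀ v x x' K → Incident (S E) v x → Incident (S E) v x' →
                    colour x ≤ K → K ≤ colour x' →
                    ∃ λ x'' → Incident (S E) v x'' × colour x'' ≡ K
  colour-interval v x x' K with vertexView v | halfView x | halfView x'
  ... | old u | half-of k s | half-of k' s' = interval-at-old u k s k' s' K
  ... | new j | half-of k s | half-of k' s' = λ i i' →
    at-new (incident-new k s i) (incident-new k' s' i')
    where
    at-new : k ≡ j → k' ≡ j → colour (half k s) ≤ K → K ≤ colour (half k' s') →
             ∃ λ x'' → Incident (S E) (n E ↑ʳ j) x'' × colour x'' ≡ K
    at-new refl refl = interval-at-new k s s' K

  colour-range : ∀ x → 1 ≤ colour x × colour x ≤ t + 1
  colour-range x with halfView x
  ... | half-of k s rewrite colour-half k s =
    ≤-trans (proj₁ (range k)) (m≤m+n (col k) _) , +-mono-≤ (proj₂ (range k)) (bit≤1 _)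

  -- Colours 1, …, t appear unshifted; colour t + 1 is the shift of colour t.
  colour-surjective : 1 ≤ t → ∀ K → 1 ≤ K → K ≤ t + 1 → ∃ λ x → colour x ≡ K
  colour-surjective 1≤t K 1≤K K≤t+1 with K ≤? t
  ... | yes K≤t with surj K 1≤K K≤t
  ...   | e , e≡K with shifted-half e false
  ...     | s , eq = half e s , trans eq (trans (+-identityʳ (col e)) e≡K)
  colour-surjective 1≤t K 1≤K K≤t+1 | no K≰t with surj t 1≤t ≤-refl
  ...   | e , e≡t with shifted-half e true
  ...     | s , eq = half e s , trans eq (trans (cong (_+ 1) e≡t) t+1≡K)
    where
    t+1≡K : t + 1 ≡ K
    t+1≡K = ≤-antisym (subst (_≤ K) (+-comm 1 t) (≰⇒> K≰t)) K≤t+1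

  subdivisionColouring : 1 ≤ t → IntervalColoring (S E) (t + 1)
  subdivisionColouring 1≤t = record
    { col      = colour
    ; range    = colour-range
    ; proper   = colour-proper
    ; surj     = colour-surjective 1≤t
    ; interval = colour-interval
    }

proposition1 : (G : Graph) → Bipartite G → InN (struct G) → InN (S (struct G))
proposition1 G (side , bipartite) (t , 1≤t , α) =
  t + 1 , m≤n+m 1 t , subdivisionColouring 1≤t
  where open SubdivisionColouring (struct G) side bipartite α
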